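{- Let $\mathcal{P}_n$ be the set of separated partitions of $[n]$ and $\mathcal{RSP}(n)$ the set of run-sorted permutations of $[n]$. Define $\theta:\mathcal{P}_n\to\mathcal{RSP}(n)$ as follows. For $P=B_1/\cdots/B_k\in\mathcal{P}_n$ in block representation, call an element $b\in B_i$ with $2\le i\le k$ movable if $b\ne\min(B_i)$ and $b-1\in B_j$ for some $j<i$. Form new blocks $C_1,\dots,C_k$ where $C_i$ consists of the non-movable elements of $B_i$ together with the movable elements of $B_{i+1}$ (with $B_{k+1}=\emptyset$), each $C_i$ arranged in increasing order; then $\theta(P)$ is the concatenation $C_1C_2\cdots C_k$. Then $\theta$ is a bijection.
   Context: A set partition of $[n]$ in block representation $B_1/\cdots/B_k$ has blocks ordered by increasing minima. It is separated if no two consecutive integers $b,b+1$ lie in the same block. A permutation of $[n]$ is run-sorted if it is the concatenation of the blocks (each in increasing order) of a set partition of $[n]$ in block representation; equivalently the minima of its successive runs (maximal increasing factors) are increasing. (In the paper, $\theta$ is described as processing $i=2,\dots,k$ in order and moving each movable $b\in B_i$ to block $i-1$, then flattening; this is the same map.) -}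

module Defs where

open import Data.Nat using (ℕ; zero; suc; _<_; _∸_; _≡ᵇ_)
open import Data.Nat.Properties using (≤-decTotalOrder)
open import Data.Bool using (Bool; not; _∧_)
open import Data.List using (List; []; _∷_; _++_; concat; filterᵇ; applyUpTo)
open import Data.Bool.ListAction using (any)
open import Data.List.Relation.Unary.All using (All)
open import Data.List.Relation.Unary.Linked using (Linked)
open import Data.List.Membership.Propositional using (_∈_)
open import Data.List.Relation.Binary.Permutation.Propositional using (_↭_)
open import Data.Product using (Σ; _×_; ∃-syntax)
open import Relation.Binary.PropositionalEquality using (_≡_; _≢_)
open import Relation.Nullary using (¬_)
open import Data.List.Sort.InsertionSort.Base ≤-decTotalOrder using (sort)

range : ℕ → List ℕ
range n = applyUpTo suc n

-- first element of a list (used only on nonempty blocks, where it is the minimum)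
hd : List ℕ → ℕ
hd []      = 0
hd (x ∷ _) = x

IsSetPartition : ℕ → List (List ℕ) → Set
IsSetPartition n Bs =
  All (λ B → B ≢ []) Bs ×
  All (Linked _<_) Bs ×
  Linked (λ B C → hd B < hd C) Bs ×
  (concat Bs ↭ range n)

IsSeparated : List (List ℕ) → Set
IsSeparated Bs = ∀ B b → B ∈ Bs → b ∈ B → ¬ (suc b ∈ B)

IsSepPartition : ℕ → List (List ℕ) → Set
IsSepPartition n Bs = IsSetPartition n Bs × IsSeparated Bs

IsRunSorted : ℕ → List ℕ → Set
IsRunSorted n σ = ∃[ Bs ] (IsSetPartition n Bs × concat Bs ≡ σ)

-- b in block B (whose predecessors' union is prev) is movable iff
-- b ≠ min B and b - 1 lies in an earlier block.
-- (For B = B₁, prev is empty, so nothing is movable, matching 2 ≤ i.)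
movable : List ℕ → List ℕ → ℕ → Bool
movable prev B b = not (b ≡ᵇ hd B) ∧ any (λ x → x ≡ᵇ (b ∸ 1)) prev

splitBlocks : List ℕ → List (List ℕ) → List (Σ (List ℕ) (λ _ → List ℕ))
splitBlocks prev []       = []
splitBlocks prev (B ∷ Bs) =
  (filterᵇ (λ b → not (movable prev B b)) B Data.Product., filterᵇ (movable prev B) B)
  ∷ splitBlocks (prev ++ B) Bs

movOfNext : List (Σ (List ℕ) (λ _ → List ℕ)) → List ℕ
movOfNext []                         = []
movOfNext ((_ Data.Product., m) ∷ _) = m

newBlocks : List (Σ (List ℕ) (λ _ → List ℕ)) → List (List ℕ)
newBlocks []                          = []
newBlocks ((nm Data.Product., _) ∷ r) = sort (nm ++ movOfNext r) ∷ newBlocks r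

θ : List (List ℕ) → List ℕ
θ Bs = concat (newBlocks (splitBlocks [] Bs))

{-# OPTIONS --safe #-}
-- θ keeps the minimum of every block in place, so its blocks C₁,…,C_k again form a set
-- partition and θ(P) is run-sorted. When P is separated, every other element b of C_i
-- exceeds an element of a later block: the minimum of B_{i+1} if b was moved, otherwise
-- b − 1 itself or the minimum of the block that b − 1 was moved out of. So the C_i are
-- exactly the pieces of θ(P) cut before its right-to-left minima, and θ(P) determines
-- them. P is recovered from C by induction on b: if C_c contains b, then b lies in
-- B_{c+1} when b ≠ min C_c and b − 1 lies in a block of index at most c, and in B_c
-- otherwise. The same recursion applied to the cut of an arbitrary run-sorted
-- permutation yields a separated partition mapped to it.

module Submission where

open import Defs
open import Data.Nat using (ℕ; zero; suc; _<_; _≤_; _∸_; _≡ᵇ_; _≤ᵇ_; z≤n; s≤s)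
open import Data.Nat.Properties
open import Data.Bool using (Bool; true; false; not; T; if_then_else_; T?)
open import Data.Bool.Properties using (T-∧)
open import Data.Bool.ListAction using (any)
open import Function using (_∘_; _⇔_; Equivalence; mk⇔)
open import Data.List using (List; []; _∷_; _++_; concat; filterᵇ; length; applyUpTo)
open import Data.List.Properties using (++-assoc; ∷-injective; length-applyUpTo)
open import Data.List.Relation.Unary.All as All using (All; []; _∷_)
import Data.List.Relation.Unary.All.Properties as Allₚ
open import Data.List.Relation.Unary.Any using (here; there)
import Data.List.Relation.Unary.Any as Any
import Data.List.Relation.Unary.Any.Properties as Anyₚ
open import Data.List.Relation.Unary.AllPairs as AllPairs using (AllPairs; []; _∷_)
open import Data.List.Relation.Unary.Linked as Linked using (Linked; []; [-]; _∷_)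
import Data.List.Relation.Unary.Linked.Properties as Linkedₚ
import Data.List.Relation.Unary.AllPairs.Properties as AllPairsₚ
open import Data.List.Relation.Unary.Unique.Propositional using (Unique)
import Data.List.Relation.Unary.Unique.Propositional.Properties as Uniqueₚ
import Data.List.Relation.Unary.Unique.Setoid.Properties as UniqueSₚ
open import Data.List.Membership.Propositional using (_∈_; find)
open import Data.List.Membership.Propositional.Properties
  using (∈-++⁺ˡ; ∈-++⁺ʳ; ∈-++⁻; ∈-filter⁻; ∈-filter⁺; ∈-applyUpTo⁻; ∈-applyUpTo⁺)
open import Data.List.Relation.Binary.Permutation.Propositional
  using (_↭_; ↭-refl; ↭-sym; ↭-trans; prep; ↭⇒↭ₛ; module PermutationReasoning)
open import Data.List.Relation.Binary.Permutation.Propositional.Properties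
  using (∈-resp-↭; shift; shifts; ++⁺ˡ; ++⁺ʳ)
import Data.List.Relation.Binary.Permutation.Setoid.Properties as Permₛ
open import Data.List.Relation.Binary.Pointwise using (Pointwise-≡⇒≡)
open import Data.List.Relation.Unary.Sorted.TotalOrder.Properties using (↗↭↗⇒≋)
open import Data.List.Relation.Binary.BagAndSetEquality using (∼bag⇒↭)
open import Data.List.Membership.Propositional.Properties.WithK using (unique∧set⇒bag)
open import Data.List.Sort.InsertionSort.Base ≤-decTotalOrder using (sort)
open import Data.List.Sort.InsertionSort.Properties ≤-decTotalOrder using (sort-↭; sort-↗)
open import Data.Product using (Σ; _×_; ∃-syntax; _,_; proj₁; proj₂; map₁; uncurry)
open import Data.Sum using (_⊎_; inj₁; inj₂)
open import Data.Empty using (⊥; ⊥-elim)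
open import Data.Unit using (⊤; tt)
open import Relation.Binary.Definitions using (Transitive; tri<; tri≈; tri>)
open import Relation.Binary.PropositionalEquality
open import Relation.Nullary using (¬_; yes; no)

head<tail : ∀ {x xs} → Linked _<_ (x ∷ xs) → All (x <_) xs
head<tail l with Linkedₚ.Linked⇒AllPairs <-trans l
... | x<xs ∷ _ = x<xs

hd-≤ : ∀ {B x} → Linked _<_ B → x ∈ B → hd B ≤ x
hd-≤ l (here refl) = ≤-refl
hd-≤ l (there x∈B) = <⇒≤ (All.lookup (head<tail l) x∈B)

hd-∈ : ∀ {B : List ℕ} → B ≢ [] → hd B ∈ B
hd-∈ {[]}    B≢[] = ⊥-elim (B≢[] refl)
hd-∈ {_ ∷ _} _    = here refl

hd-≡ : ∀ {B h} → Linked _<_ B → h ∈ B → (∀ {y} → y ∈ B → h ≤ y) → hd B ≡ h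
hd-≡ {_ ∷ _} l h∈B h≤B = ≤-antisym (hd-≤ l h∈B) (h≤B (here refl))

∈⇒≢[] : ∀ {x} {B : List ℕ} → x ∈ B → B ≢ []
∈⇒≢[] (here _)  ()
∈⇒≢[] (there _) ()

Linked≤∧Unique⇒Linked< : ∀ {xs : List ℕ} → Linked _≤_ xs → Unique xs → Linked _<_ xs
Linked≤∧Unique⇒Linked< []      _              = []
Linked≤∧Unique⇒Linked< [-]     _              = [-]
Linked≤∧Unique⇒Linked< (p ∷ l) ((x≢ ∷ _) ∷ u) = ≤∧≢⇒< p x≢ ∷ Linked≤∧Unique⇒Linked< l u

Unique-↭ : ∀ {xs ys : List ℕ} → xs ↭ ys → Unique xs → Unique ys
Unique-↭ p = Permₛ.Unique-resp-↭ (setoid ℕ) (↭⇒↭ₛ p)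

Unique-++-disjoint : ∀ (xs : List ℕ) {ys x} → Unique (xs ++ ys) → x ∈ xs → x ∈ ys → ⊥
Unique-++-disjoint (_ ∷ xs) (x∉ ∷ _) (here refl) x∈ys = All.lookup x∉ (∈-++⁺ʳ xs x∈ys) refl
Unique-++-disjoint (_ ∷ xs) (_ ∷ u)  (there x∈xs) x∈ys = Unique-++-disjoint xs u x∈xs x∈ys

Unique-++⁻ˡ : ∀ (xs : List ℕ) {ys} → Unique (xs ++ ys) → Unique xs
Unique-++⁻ˡ []       _         = []
Unique-++⁻ˡ (x ∷ xs) (x∉ ∷ u) = Allₚ.++⁻ˡ xs x∉ ∷ Unique-++⁻ˡ xs u

Unique-++⁻ʳ : ∀ (xs : List ℕ) {ys} → Unique (xs ++ ys) → Unique ys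
Unique-++⁻ʳ []       u       = u
Unique-++⁻ʳ (x ∷ xs) (_ ∷ u) = Unique-++⁻ʳ xs u

Unique∧sameMembers⇒↭ : ∀ {xs ys : List ℕ} → Unique xs → Unique ys →
  (∀ {x} → x ∈ xs ⇔ x ∈ ys) → xs ↭ ys
Unique∧sameMembers⇒↭ u u′ xs⇔ys = ∼bag⇒↭ (unique∧set⇒bag u u′ xs⇔ys)

strictlySorted-ext : ∀ {xs ys : List ℕ} → Linked _<_ xs → Linked _<_ ys →
  (∀ {z} → z ∈ xs → z ∈ ys) → (∀ {z} → z ∈ ys → z ∈ xs) → xs ≡ ys
strictlySorted-ext lx ly xs⊆ys ys⊆xs = Pointwise-≡⇒≡ (↗↭↗⇒≋ ≤-totalOrder
  (Linked.map <⇒≤ lx) (Linked.map <⇒≤ ly)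
  (↭⇒↭ₛ (Unique∧sameMembers⇒↭ (Linked<⇒Unique lx) (Linked<⇒Unique ly) (mk⇔ xs⊆ys ys⊆xs))))
  where
  Linked<⇒Unique : ∀ {zs : List ℕ} → Linked _<_ zs → Unique zs
  Linked<⇒Unique = AllPairs.map <⇒≢ ∘ Linkedₚ.Linked⇒AllPairs <-trans

∈-range⁻ : ∀ {n x} → x ∈ range n → 0 < x × x ≤ n
∈-range⁻ x∈ with ∈-applyUpTo⁻ suc x∈
... | _ , i<n , refl = s≤s z≤n , i<n

∈-range⁺ : ∀ {n x} → 0 < x → x ≤ n → x ∈ range n
∈-range⁺ {x = suc x} _ x≤n = ∈-applyUpTo⁺ suc x≤n

range-unique : ∀ n → Unique (range n)
range-unique n = Uniqueₚ.applyUpTo⁺₁ suc n (λ i<j _ i≡j → <-irrefl (suc-injective i≡j) i<j)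

range-sorted : ∀ n → Linked _<_ (range n)
range-sorted n = Linkedₚ.applyUpTo⁺₁ suc n (λ _ → ≤-refl)

block : List (List ℕ) → ℕ → List ℕ
block []       _       = []
block (B ∷ _)  zero    = B
block (_ ∷ Bs) (suc i) = block Bs i

block⊆concat : ∀ Bs i {x} → x ∈ block Bs i → x ∈ concat Bs
block⊆concat (B ∷ _)  zero    x∈ = ∈-++⁺ˡ x∈
block⊆concat (B ∷ Bs) (suc i) x∈ = ∈-++⁺ʳ B (block⊆concat Bs i x∈)

concat⇒block : ∀ Bs {x} → x ∈ concat Bs → ∃[ i ] (x ∈ block Bs i)
concat⇒block (B ∷ Bs) x∈ with ∈-++⁻ B x∈
... | inj₁ x∈B = 0 , x∈B
... | inj₂ x∈Bs with concat⇒block Bs x∈Bs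
... | i , x∈Bᵢ = suc i , x∈Bᵢ

∈-block⇒<length : ∀ Bs i {x} → x ∈ block Bs i → i < length Bs
∈-block⇒<length (_ ∷ _)  zero    _  = s≤s z≤n
∈-block⇒<length (_ ∷ Bs) (suc i) x∈ = s≤s (∈-block⇒<length Bs i x∈)

block-≥length : ∀ Bs {i} → length Bs ≤ i → block Bs i ≡ []
block-≥length []                 _         = refl
block-≥length (_ ∷ Bs) {suc i} (s≤s le) = block-≥length Bs le

block-ext : ∀ Bs Cs → length Bs ≡ length Cs → (∀ i → block Bs i ≡ block Cs i) → Bs ≡ Cs
block-ext []       []       _   _  = refl
block-ext (B ∷ Bs) (C ∷ Cs) len eq =
  cong₂ _∷_ (eq 0) (block-ext Bs Cs (suc-injective len) (eq ∘ suc))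

block-∈ : ∀ Bs {i} → i < length Bs → block Bs i ∈ Bs
block-∈ (_ ∷ _)  {zero}  _        = here refl
block-∈ (_ ∷ Bs) {suc i} (s≤s i<) = there (block-∈ Bs i<)

∈⇒block : ∀ Bs {B} → B ∈ Bs → ∃[ i ] (block Bs i ≡ B)
∈⇒block (_ ∷ _)  (here refl) = 0 , refl
∈⇒block (_ ∷ Bs) (there B∈)  with ∈⇒block Bs B∈
... | i , eq = suc i , eq

block-index-unique : ∀ Bs {x i j} → Unique (concat Bs) →
  x ∈ block Bs i → x ∈ block Bs j → i ≡ j
block-index-unique (B ∷ Bs) {i = zero}  {zero}  _ _  _  = refl
block-index-unique (B ∷ Bs) {i = zero}  {suc j} u x∈ x∈′ =
  ⊥-elim (Unique-++-disjoint B u x∈ (block⊆concat Bs j x∈′))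
block-index-unique (B ∷ Bs) {i = suc i} {zero}  u x∈ x∈′ =
  ⊥-elim (Unique-++-disjoint B u x∈′ (block⊆concat Bs i x∈))
block-index-unique (B ∷ Bs) {i = suc i} {suc j} u x∈ x∈′ =
  cong suc (block-index-unique Bs (Unique-++⁻ʳ B u) x∈ x∈′)

block-unique : ∀ Bs i → Unique (concat Bs) → Unique (block Bs i)
block-unique []       _       _ = []
block-unique (B ∷ Bs) zero    u = Unique-++⁻ˡ B u
block-unique (B ∷ Bs) (suc i) u = block-unique Bs i (Unique-++⁻ʳ B u)

block-sorted : ∀ Bs i → All (Linked _<_) Bs → Linked _<_ (block Bs i)
block-sorted []       _       _       = []
block-sorted (_ ∷ _)  zero    (s ∷ _) = s
block-sorted (_ ∷ Bs) (suc i) (_ ∷ a) = block-sorted Bs i a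

block-All : ∀ {Q : List ℕ → Set} Bs → (∀ i → i < length Bs → Q (block Bs i)) → All Q Bs
block-All []       _ = []
block-All (B ∷ Bs) q = q 0 (s≤s z≤n) ∷ block-All Bs (λ i i< → q (suc i) (s≤s i<))

block-Linked : ∀ {R : List ℕ → List ℕ → Set} Bs →
  (∀ i → suc i < length Bs → R (block Bs i) (block Bs (suc i))) → Linked R Bs
block-Linked []           _ = []
block-Linked (_ ∷ [])     _ = [-]
block-Linked (_ ∷ C ∷ Bs) r =
  r 0 (s≤s (s≤s z≤n)) ∷ block-Linked (C ∷ Bs) (λ i i< → r (suc i) (s≤s i<))

AllPairs-block : ∀ {R : List ℕ → List ℕ → Set} {Bs i j} → AllPairs R Bs →
  i < j → j < length Bs → R (block Bs i) (block Bs j)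
AllPairs-block {Bs = _ ∷ Bs} {zero}  {suc j} (r ∷ _) _          (s≤s j<) = All.lookup r (block-∈ Bs j<)
AllPairs-block {Bs = _ ∷ Bs} {suc i} {suc j} (_ ∷ a) (s≤s i<j) (s≤s j<) = AllPairs-block a i<j j<

_<ₕ_ : List ℕ → List ℕ → Set
B <ₕ C = hd B < hd C

<ₕ-trans : Transitive _<ₕ_
<ₕ-trans {A} {B} {C} = <-trans {hd A} {hd B} {hd C}

module SetPartition {n : ℕ} {P : List (List ℕ)} (sp : IsSetPartition n P) where

  nonempty : All (λ B → B ≢ []) P
  nonempty = proj₁ sp

  sorted : All (Linked _<_) P
  sorted = proj₁ (proj₂ sp)

  hd-increasing : Linked _<ₕ_ P
  hd-increasing = proj₁ (proj₂ (proj₂ sp))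

  concat↭range : concat P ↭ range n
  concat↭range = proj₂ (proj₂ (proj₂ sp))

  unique : Unique (concat P)
  unique = Unique-↭ (↭-sym concat↭range) (range-unique n)

  blockSorted : ∀ i → Linked _<_ (block P i)
  blockSorted i = block-sorted P i sorted

  bounds : ∀ {x i} → x ∈ block P i → 0 < x × x ≤ n
  bounds {i = i} x∈ = ∈-range⁻ (∈-resp-↭ concat↭range (block⊆concat P i x∈))

  index : ∀ {x} → 0 < x → x ≤ n → ∃[ i ] (x ∈ block P i)
  index 0<x x≤n = concat⇒block P (∈-resp-↭ (↭-sym concat↭range) (∈-range⁺ 0<x x≤n))

  index-unique : ∀ {x i j} → x ∈ block P i → x ∈ block P j → i ≡ j
  index-unique = block-index-unique P unique

  <length : ∀ {x i} → x ∈ block P i → i < length P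
  <length {i = i} = ∈-block⇒<length P i

  hd≤ : ∀ {x i} → x ∈ block P i → hd (block P i) ≤ x
  hd≤ {i = i} = hd-≤ (blockSorted i)

  hd∈ : ∀ {i} → i < length P → hd (block P i) ∈ block P i
  hd∈ i< = hd-∈ (All.lookup nonempty (block-∈ P i<))

  hd< : ∀ {i j} → i < j → j < length P → hd (block P i) < hd (block P j)
  hd< = AllPairs-block (Linkedₚ.Linked⇒AllPairs (λ {A} {B} {C} → <ₕ-trans {A} {B} {C}) hd-increasing)

  hd<nonHd : ∀ {x i} → x ∈ block P i → x ≢ hd (block P i) → hd (block P i) < x
  hd<nonHd x∈ x≢hd = ≤∧≢⇒< (hd≤ x∈) (x≢hd ∘ sym)

  pred-bounds : ∀ {x i} → x ∈ block P i → x ≢ hd (block P i) → 0 < x ∸ 1 × x ∸ 1 ≤ n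
  pred-bounds {zero}  x∈ _    = ⊥-elim (<-irrefl refl (proj₁ (bounds x∈)))
  pred-bounds {suc b} x∈ x≢hd =
    <-≤-trans (proj₁ (bounds (hd∈ (<length x∈)))) (≤-pred (hd<nonHd x∈ x≢hd)) ,
    <⇒≤ (proj₂ (bounds x∈))

  pred-index : ∀ {x i} → x ∈ block P i → x ≢ hd (block P i) → ∃[ j ] (x ∸ 1 ∈ block P j)
  pred-index x∈ x≢hd = let 0<x-1 , x-1≤n = pred-bounds x∈ x≢hd in index 0<x-1 x-1≤n

T-not⁺ : ∀ {a} → ¬ T a → T (not a)
T-not⁺ {true}  ¬t = ¬t tt
T-not⁺ {false} _  = tt

T-not⁻ : ∀ {a} → T (not a) → ¬ T a
T-not⁻ {true} () _

∈⇒T-any : ∀ {xs : List ℕ} {y} → y ∈ xs → T (any (_≡ᵇ y) xs)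
∈⇒T-any {y = y} y∈ = Anyₚ.any⁺ (_≡ᵇ y) (Any.map (λ {x} y≡x → ≡⇒≡ᵇ x y (sym y≡x)) y∈)

T-any⇒∈ : ∀ (xs : List ℕ) {y} → T (any (_≡ᵇ y) xs) → y ∈ xs
T-any⇒∈ xs {y} t = Any.map (λ {x} t′ → sym (≡ᵇ⇒≡ x y t′)) (Anyₚ.any⁻ (_≡ᵇ y) xs t)

movable⁻ : ∀ prev B b → T (movable prev B b) → b ≢ hd B × b ∸ 1 ∈ prev
movable⁻ prev B b t with Equivalence.to T-∧ t
... | not-hd , below = (λ b≡hd → T-not⁻ not-hd (≡⇒≡ᵇ b (hd B) b≡hd)) , T-any⇒∈ prev below

movable⁺ : ∀ prev B b → b ≢ hd B → b ∸ 1 ∈ prev → T (movable prev B b)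
movable⁺ prev B b b≢hd b-1∈ =
  Equivalence.from T-∧ (T-not⁺ (b≢hd ∘ ≡ᵇ⇒≡ b (hd B)) , ∈⇒T-any b-1∈)

-- `earlier acc Bs i` is the argument `prev` with which `splitBlocks acc Bs` treats block i.
earlier : List ℕ → List (List ℕ) → ℕ → List ℕ
earlier acc _        zero    = acc
earlier acc []       (suc i) = acc
earlier acc (B ∷ Bs) (suc i) = earlier (acc ++ B) Bs i

∈-earlier⁻ : ∀ acc Bs i {x} → x ∈ earlier acc Bs i →
  x ∈ acc ⊎ ∃[ j ] (j < i × x ∈ block Bs j)
∈-earlier⁻ acc Bs       zero    x∈ = inj₁ x∈
∈-earlier⁻ acc []       (suc i) x∈ = inj₁ x∈
∈-earlier⁻ acc (B ∷ Bs) (suc i) x∈ with ∈-earlier⁻ (acc ++ B) Bs i x∈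
... | inj₂ (j , j<i , x∈Bⱼ) = inj₂ (suc j , s≤s j<i , x∈Bⱼ)
... | inj₁ x∈acc++B with ∈-++⁻ acc x∈acc++B
... | inj₁ x∈acc = inj₁ x∈acc
... | inj₂ x∈B   = inj₂ (0 , s≤s z≤n , x∈B)

acc⊆earlier : ∀ acc Bs i {x} → x ∈ acc → x ∈ earlier acc Bs i
acc⊆earlier acc Bs       zero    x∈ = x∈
acc⊆earlier acc []       (suc i) x∈ = x∈
acc⊆earlier acc (B ∷ Bs) (suc i) x∈ = acc⊆earlier (acc ++ B) Bs i (∈-++⁺ˡ x∈)

∈-earlier⁺ : ∀ acc Bs {i j x} → j < i → x ∈ block Bs j → x ∈ earlier acc Bs i
∈-earlier⁺ acc (B ∷ Bs) {suc i} {zero}  _         x∈ =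
  acc⊆earlier (acc ++ B) Bs i (∈-++⁺ʳ acc x∈)
∈-earlier⁺ acc (B ∷ Bs) {suc i} {suc j} (s≤s j<i) x∈ = ∈-earlier⁺ (acc ++ B) Bs j<i x∈

Movable : List (List ℕ) → ℕ → ℕ → Set
Movable P i x = T (movable (earlier [] P i) (block P i) x)

Movable⁻ : ∀ P i x → Movable P i x →
  x ≢ hd (block P i) × ∃[ j ] (j < i × x ∸ 1 ∈ block P j)
Movable⁻ P i x mv with movable⁻ (earlier [] P i) (block P i) x mv
... | x≢hd , x-1∈ with ∈-earlier⁻ [] P i x-1∈
... | inj₂ below = x≢hd , below

Movable⁺ : ∀ P i {j x} → x ≢ hd (block P i) → j < i → x ∸ 1 ∈ block P j → Movable P i x
Movable⁺ P i {x = x} x≢hd j<i x-1∈ =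
  movable⁺ (earlier [] P i) (block P i) x x≢hd (∈-earlier⁺ [] P j<i x-1∈)

hd-not-Movable : ∀ P i → ¬ Movable P i (hd (block P i))
hd-not-Movable P i mv = proj₁ (Movable⁻ P i _ mv) refl

stay : List ℕ → List ℕ → List ℕ
stay prev B = filterᵇ (not ∘ movable prev B) B

moved : List ℕ → List ℕ → List ℕ
moved prev B = filterᵇ (movable prev B) B

θBlocks : List (List ℕ) → List (List ℕ)
θBlocks P = newBlocks (splitBlocks [] P)

block-newBlocks : ∀ acc P i → block (newBlocks (splitBlocks acc P)) i ≡
  sort (stay (earlier acc P i) (block P i) ++ moved (earlier acc P (suc i)) (block P (suc i)))
block-newBlocks acc []       i       = refl
block-newBlocks acc (B ∷ []) zero    = refl
block-newBlocks acc (B ∷ C ∷ P) zero = refl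
block-newBlocks acc (B ∷ P)  (suc i) = block-newBlocks (acc ++ B) P i

length-newBlocks : ∀ acc P → length (newBlocks (splitBlocks acc P)) ≡ length P
length-newBlocks acc []      = refl
length-newBlocks acc (B ∷ P) = cong suc (length-newBlocks (acc ++ B) P)

∈-filterᵇ⁻ : ∀ (p : ℕ → Bool) {xs x} → x ∈ filterᵇ p xs → x ∈ xs × T (p x)
∈-filterᵇ⁻ p = ∈-filter⁻ (T? ∘ p)

∈-filterᵇ⁺ : ∀ (p : ℕ → Bool) {xs x} → x ∈ xs → T (p x) → x ∈ filterᵇ p xs
∈-filterᵇ⁺ p = ∈-filter⁺ (T? ∘ p)

∈-θBlocks⁻ : ∀ P i {x} → x ∈ block (θBlocks P) i →
  (x ∈ block P i × ¬ Movable P i x) ⊎ (x ∈ block P (suc i) × Movable P (suc i) x)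
∈-θBlocks⁻ P i {x} x∈
  with ∈-++⁻ (stay (earlier [] P i) (block P i))
         (∈-resp-↭ (sort-↭ _) (subst (x ∈_) (block-newBlocks [] P i) x∈))
... | inj₁ x∈stay  = let x∈B , t = ∈-filterᵇ⁻ _ x∈stay in inj₁ (x∈B , T-not⁻ t)
... | inj₂ x∈moved = inj₂ (∈-filterᵇ⁻ _ x∈moved)

∈-sort⁺ : ∀ {xs x} → x ∈ xs → x ∈ sort xs
∈-sort⁺ = ∈-resp-↭ (↭-sym (sort-↭ _))

∈-θBlocks⁺ˢ : ∀ P i {x} → x ∈ block P i → ¬ Movable P i x → x ∈ block (θBlocks P) i
∈-θBlocks⁺ˢ P i x∈ ¬mv = subst (_ ∈_) (sym (block-newBlocks [] P i))
  (∈-sort⁺ (∈-++⁺ˡ (∈-filterᵇ⁺ _ x∈ (T-not⁺ ¬mv))))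

∈-θBlocks⁺ᵐ : ∀ P i {x} → x ∈ block P (suc i) → Movable P (suc i) x → x ∈ block (θBlocks P) i
∈-θBlocks⁺ᵐ P i x∈ mv = subst (_ ∈_) (sym (block-newBlocks [] P i))
  (∈-sort⁺ (∈-++⁺ʳ (stay (earlier [] P i) (block P i)) (∈-filterᵇ⁺ _ x∈ mv)))

unsplit : List (Σ (List ℕ) (λ _ → List ℕ)) → List ℕ
unsplit []            = []
unsplit ((s , m) ∷ S) = (s ++ m) ++ unsplit S

newBlocks-↭ : ∀ S → movOfNext S ++ concat (newBlocks S) ↭ unsplit S
newBlocks-↭ []            = ↭-refl
newBlocks-↭ ((s , m) ∷ S) = begin
  m ++ sort (s ++ movOfNext S) ++ concat (newBlocks S)
    ↭⟨ ++⁺ˡ m (++⁺ʳ (concat (newBlocks S)) (sort-↭ (s ++ movOfNext S))) ⟩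
  m ++ (s ++ movOfNext S) ++ concat (newBlocks S)      ≡⟨ cong (m ++_) (++-assoc s _ _) ⟩
  m ++ s ++ movOfNext S ++ concat (newBlocks S)        ↭⟨ ++⁺ˡ m (++⁺ˡ s (newBlocks-↭ S)) ⟩
  m ++ s ++ unsplit S                                  ↭⟨ shifts m s ⟩
  s ++ m ++ unsplit S                                  ≡⟨ ++-assoc s m _ ⟨
  (s ++ m) ++ unsplit S                                ∎
  where open PermutationReasoning

filterᵇ-partition-↭ : ∀ (p : ℕ → Bool) xs → filterᵇ (not ∘ p) xs ++ filterᵇ p xs ↭ xs
filterᵇ-partition-↭ p []       = ↭-refl
filterᵇ-partition-↭ p (x ∷ xs) with p x
... | true  = ↭-trans (shift x _ _) (prep x (filterᵇ-partition-↭ p xs))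
... | false = prep x (filterᵇ-partition-↭ p xs)

unsplit-↭ : ∀ acc P → unsplit (splitBlocks acc P) ↭ concat P
unsplit-↭ acc []      = ↭-refl
unsplit-↭ acc (B ∷ P) =
  ↭-trans (++⁺ʳ _ (filterᵇ-partition-↭ (movable acc B) B)) (++⁺ˡ B (unsplit-↭ (acc ++ B) P))

moved-[] : ∀ B xs → filterᵇ (movable [] B) xs ≡ []
moved-[] B []       = refl
moved-[] B (x ∷ xs) with not (x ≡ᵇ hd B)
... | true  = moved-[] B xs
... | false = moved-[] B xs

θBlocks-↭ : ∀ P → concat (θBlocks P) ↭ concat P
θBlocks-↭ []      = ↭-refl
θBlocks-↭ (B ∷ P) =
  ↭-trans (subst (λ m → m ++ concat (θBlocks (B ∷ P)) ↭ unsplit (splitBlocks [] (B ∷ P)))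
                 (moved-[] B B) (newBlocks-↭ (splitBlocks [] (B ∷ P))))
          (unsplit-↭ [] (B ∷ P))

module ThetaBlocks {n : ℕ} {P : List (List ℕ)} (sp : IsSetPartition n P) where
  open SetPartition sp public

  C : List (List ℕ)
  C = θBlocks P

  length-C : length C ≡ length P
  length-C = length-newBlocks [] P

  concatC↭range : concat C ↭ range n
  concatC↭range = ↭-trans (θBlocks-↭ P) concat↭range

  sorted-C : ∀ i → Linked _<_ (block C i)
  sorted-C i = Linked≤∧Unique⇒Linked<
    (subst (Linked _≤_) (sym (block-newBlocks [] P i))
      (sort-↗ (stay (earlier [] P i) (block P i) ++ moved (earlier [] P (suc i)) (block P (suc i)))))
    (block-unique C i (Unique-↭ (↭-sym concatC↭range) (range-unique n)))

  <length-C : ∀ {x c} → x ∈ block C c → c < length P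
  <length-C {c = c} x∈ = subst (c <_) length-C (∈-block⇒<length C c x∈)

  hdP∈C : ∀ {i} → i < length P → hd (block P i) ∈ block C i
  hdP∈C {i} i< = ∈-θBlocks⁺ˢ P i (hd∈ i<) (hd-not-Movable P i)

  hd-C : ∀ {i} → i < length P → hd (block C i) ≡ hd (block P i)
  hd-C {i} i< = hd-≡ (sorted-C i) (hdP∈C i<) hdP≤
    where
    hdP≤ : ∀ {y} → y ∈ block C i → hd (block P i) ≤ y
    hdP≤ y∈ with ∈-θBlocks⁻ P i y∈
    ... | inj₁ (y∈Bᵢ , _)  = hd≤ y∈Bᵢ
    ... | inj₂ (y∈Bᵢ₊₁ , _) = ≤-trans (<⇒≤ (hd< ≤-refl (<length y∈Bᵢ₊₁))) (hd≤ y∈Bᵢ₊₁)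

  C-isSetPartition : IsSetPartition n C
  C-isSetPartition =
      block-All C (λ i i< → ∈⇒≢[] (hdP∈C (subst (i <_) length-C i<)))
    , block-All C (λ i _ → sorted-C i)
    , block-Linked C (λ i i< → let i+1< = subst (suc i <_) length-C i< in
        subst₂ _<_ (sym (hd-C (<-trans ≤-refl i+1<))) (sym (hd-C i+1<)) (hd< ≤-refl i+1<))
    , concatC↭range

  placement : ∀ {x j} → x ∈ block P j →
    x ∈ block C j ⊎ ∃[ i ] (j ≡ suc i × Movable P j x × x ∈ block C i)
  placement {x} {j} x∈ with T? (movable (earlier [] P j) (block P j) x)
  ... | no ¬mv = inj₁ (∈-θBlocks⁺ˢ P j x∈ ¬mv)
  placement {x} {zero}  x∈ | yes mv with Movable⁻ P 0 x mv
  ... | _ , _ , () , _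
  placement {x} {suc i} x∈ | yes mv = inj₂ (i , refl , mv , ∈-θBlocks⁺ᵐ P i x∈ mv)

θ-runSorted : ∀ {n P} → IsSetPartition n P → IsRunSorted n (θ P)
θ-runSorted {P = P} sp = θBlocks P , ThetaBlocks.C-isSetPartition sp , refl

ExceedsSomeOf : List ℕ → List ℕ → Set
ExceedsSomeOf t w = ∀ {y} → y ∈ t → ∃[ z ] (z ∈ w × z < y)

exceeds⇒¬below : ∀ {y} p {w} → ExceedsSomeOf (y ∷ p) w → ¬ All (y <_) (p ++ w)
exceeds⇒¬below p y> y<p++w with y> (here refl)
... | z , z∈w , z<y = <-asym z<y (All.lookup y<p++w (∈-++⁺ʳ p z∈w))

-- A right-to-left minimum of a word is an element smaller than every later one.
-- The two predicates below say that Cs cuts concat Cs exactly before its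
-- right-to-left minima.
HeadsRLMin : List (List ℕ) → Set
HeadsRLMin []             = ⊤
HeadsRLMin ([] ∷ _)       = ⊥
HeadsRLMin ((h ∷ t) ∷ Cs) = All (h <_) (t ++ concat Cs) × HeadsRLMin Cs

TailsNotRLMin : List (List ℕ) → Set
TailsNotRLMin []       = ⊤
TailsNotRLMin (B ∷ Cs) =
  (∀ {y} → y ∈ B → y ≢ hd B → ∃[ z ] (z ∈ concat Cs × z < y)) × TailsNotRLMin Cs

HeadsRLMin⇒head< : ∀ Cs {y w} → HeadsRLMin Cs → concat Cs ≡ y ∷ w → All (y <_) w
HeadsRLMin⇒head< ((h ∷ t) ∷ Cs) (h<rest , _) eq with ∷-injective eq
... | refl , refl = h<rest

tail-exceeds : ∀ {h t Cs} → HeadsRLMin ((h ∷ t) ∷ Cs) → TailsNotRLMin ((h ∷ t) ∷ Cs) →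
  ExceedsSomeOf t (concat Cs)
tail-exceeds {t = t} (h<rest , _) (exceeds , _) y∈t =
  exceeds (there y∈t) (λ y≡h → <-irrefl (sym y≡h) (All.lookup (Allₚ.++⁻ˡ t h<rest) y∈t))

mutual
  rlMinBlocks-unique : ∀ Cs Ds →
    HeadsRLMin Cs → TailsNotRLMin Cs → HeadsRLMin Ds → TailsNotRLMin Ds →
    concat Cs ≡ concat Ds → Cs ≡ Ds
  rlMinBlocks-unique []             []             _  _  _  _  _  = refl
  rlMinBlocks-unique []             ([] ∷ _)       _  _  () _  _
  rlMinBlocks-unique []             ((_ ∷ _) ∷ _)  _  _  _  _  ()
  rlMinBlocks-unique ([] ∷ _)       _              () _  _  _  _
  rlMinBlocks-unique ((_ ∷ _) ∷ _)  []             _  _  _  _  ()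
  rlMinBlocks-unique ((_ ∷ _) ∷ _)  ([] ∷ _)       _  _  () _  _
  rlMinBlocks-unique ((c ∷ C) ∷ Cs) ((d ∷ D) ∷ Ds) hC tC hD tD eq with ∷-injective eq
  ... | refl , eq′
    with prefixed-rlMinBlocks-unique C D Cs Ds (proj₂ hC) (proj₂ tC) (proj₂ hD) (proj₂ tD)
           (tail-exceeds hC tC) (tail-exceeds hD tD) eq′
  ... | refl , refl = refl

  prefixed-rlMinBlocks-unique : ∀ t t′ Cs Ds →
    HeadsRLMin Cs → TailsNotRLMin Cs → HeadsRLMin Ds → TailsNotRLMin Ds →
    ExceedsSomeOf t (concat Cs) → ExceedsSomeOf t′ (concat Ds) →
    t ++ concat Cs ≡ t′ ++ concat Ds → t ≡ t′ × Cs ≡ Ds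
  prefixed-rlMinBlocks-unique [] [] Cs Ds hC tC hD tD _ _ eq =
    refl , rlMinBlocks-unique Cs Ds hC tC hD tD eq
  prefixed-rlMinBlocks-unique [] (y ∷ t′) Cs Ds hC _ _ _ _ t′> eq =
    ⊥-elim (exceeds⇒¬below t′ t′> (HeadsRLMin⇒head< Cs hC eq))
  prefixed-rlMinBlocks-unique (y ∷ t) [] Cs Ds _ _ hD _ t> _ eq =
    ⊥-elim (exceeds⇒¬below t t> (HeadsRLMin⇒head< Ds hD (sym eq)))
  prefixed-rlMinBlocks-unique (a ∷ t) (b ∷ t′) Cs Ds hC tC hD tD t> t′> eq with ∷-injective eq
  ... | refl , eq′
    with prefixed-rlMinBlocks-unique t t′ Cs Ds hC tC hD tD (t> ∘ there) (t′> ∘ there) eq′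
  ... | refl , refl = refl , refl

setPartition⇒HeadsRLMin : ∀ {n Bs} → IsSetPartition n Bs → HeadsRLMin Bs
setPartition⇒HeadsRLMin (nonempty , sorted , hd-increasing , _) = go _ nonempty sorted hd-increasing
  where
  above : ∀ {h} Bs → All (Linked _<_) Bs → All (λ B → h < hd B) Bs → All (h <_) (concat Bs)
  above []            _       _          = []
  above ([] ∷ Bs)     (_ ∷ s) (_ ∷ h<)   = above Bs s h<
  above ((b ∷ B) ∷ Bs) (s ∷ ss) (h<b ∷ h<) =
    Allₚ.++⁺ (h<b ∷ All.map (<-trans h<b) (head<tail s)) (above Bs ss h<)

  go : ∀ Bs → All (λ B → B ≢ []) Bs → All (Linked _<_) Bs → Linked _<ₕ_ Bs → HeadsRLMin Bs
  go []             _           _        _  = tt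
  go ([] ∷ _)       ([]≢[] ∷ _) _        _  = ⊥-elim ([]≢[] refl)
  go ((h ∷ t) ∷ Bs) (_ ∷ ne)    (s ∷ ss) l  =
    Allₚ.++⁺ (head<tail s) (above Bs ss (heads-above l)) , go Bs ne ss (Linked.tail l)
    where
    heads-above : ∀ {Bs} → Linked _<ₕ_ ((h ∷ t) ∷ Bs) → All (λ B → h < hd B) Bs
    heads-above [-]     = []
    heads-above (r ∷ l) = Linkedₚ.Linked⇒All (λ {A} {B} {C} → <ₕ-trans {A} {B} {C}) {v = h ∷ t} r l

HeadsRLMin⇒hd< : ∀ Cs → HeadsRLMin Cs → ∀ {i j z} → i < j → z ∈ block Cs j → hd (block Cs i) < z
HeadsRLMin⇒hd< ((h ∷ t) ∷ Cs) (h<rest , _) {zero}  {suc j} _         z∈ =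
  All.lookup h<rest (∈-++⁺ʳ t (block⊆concat Cs j z∈))
HeadsRLMin⇒hd< ((h ∷ t) ∷ Cs) (_ , hCs)    {suc i} {suc j} (s≤s i<j) z∈ =
  HeadsRLMin⇒hd< Cs hCs i<j z∈

HeadsRLMin⇒nonempty : ∀ Cs → HeadsRLMin Cs → All (λ B → B ≢ []) Cs
HeadsRLMin⇒nonempty []             _         = []
HeadsRLMin⇒nonempty ((h ∷ t) ∷ Cs) (_ , hCs) = (λ ()) ∷ HeadsRLMin⇒nonempty Cs hCs

TailsExceedLater : List (List ℕ) → Set
TailsExceedLater Cs = ∀ i {y} → y ∈ block Cs i → y ≢ hd (block Cs i) →
  ∃[ z ] ∃[ j ] (i < j × z ∈ block Cs j × z < y)

TailsNotRLMin⇒TailsExceedLater : ∀ Cs → TailsNotRLMin Cs → TailsExceedLater Cs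
TailsNotRLMin⇒TailsExceedLater (B ∷ Cs) (exceeds , _) zero y∈ y≢hd with exceeds y∈ y≢hd
... | z , z∈ , z<y with concat⇒block Cs z∈
... | j , z∈Cⱼ = z , suc j , s≤s z≤n , z∈Cⱼ , z<y
TailsNotRLMin⇒TailsExceedLater (B ∷ Cs) (_ , tCs) (suc i) y∈ y≢hd
  with TailsNotRLMin⇒TailsExceedLater Cs tCs i y∈ y≢hd
... | z , j , i<j , z∈Cⱼ , z<y = z , suc j , s≤s i<j , z∈Cⱼ , z<y

TailsExceedLater⇒TailsNotRLMin : ∀ Cs → TailsExceedLater Cs → TailsNotRLMin Cs
TailsExceedLater⇒TailsNotRLMin []       _       = tt
TailsExceedLater⇒TailsNotRLMin (B ∷ Cs) exceeds =
  first , TailsExceedLater⇒TailsNotRLMin Cs (λ i y∈ y≢hd → unshift (exceeds (suc i) y∈ y≢hd))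
  where
  first : ∀ {y} → y ∈ B → y ≢ hd B → ∃[ z ] (z ∈ concat Cs × z < y)
  first y∈ y≢hd with exceeds 0 y∈ y≢hd
  ... | z , suc j , _ , z∈Cⱼ , z<y = z , block⊆concat Cs j z∈Cⱼ , z<y

  unshift : ∀ {i y} → ∃[ z ] ∃[ j ] (suc i < j × z ∈ block (B ∷ Cs) j × z < y) →
    ∃[ z ] ∃[ j ] (i < j × z ∈ block Cs j × z < y)
  unshift (z , suc j , s≤s i<j , z∈Cⱼ , z<y) = z , j , i<j , z∈Cⱼ , z<y

AscentOrRLMin : List ℕ → Set
AscentOrRLMin []          = ⊤
AscentOrRLMin (_ ∷ [])    = ⊤
AscentOrRLMin (x ∷ y ∷ w) = (x < y ⊎ All (y <_) w) × AscentOrRLMin (y ∷ w)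

FirstRLMin : List ℕ → Set
FirstRLMin []      = ⊤
FirstRLMin (y ∷ w) = All (y <_) w

AscentOrRLMin-tail : ∀ {x xs} → AscentOrRLMin (x ∷ xs) → AscentOrRLMin xs
AscentOrRLMin-tail {xs = []}    _       = tt
AscentOrRLMin-tail {xs = _ ∷ _} (_ , w) = w

AscentOrRLMin-++ : ∀ h t w → Linked _<_ (h ∷ t) → AscentOrRLMin w → FirstRLMin w →
  AscentOrRLMin (h ∷ t ++ w)
AscentOrRLMin-++ h []      []      _       _  _     = tt
AscentOrRLMin-++ h []      (y ∷ w) _       aw y<w   = inj₂ y<w , aw
AscentOrRLMin-++ h (x ∷ t) w       (h<x ∷ l) aw fw = inj₁ h<x , AscentOrRLMin-++ x t w l aw fw

concat-AscentOrRLMin : ∀ Bs → HeadsRLMin Bs → All (Linked _<_) Bs →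
  AscentOrRLMin (concat Bs) × FirstRLMin (concat Bs)
concat-AscentOrRLMin []             _            _        = tt , tt
concat-AscentOrRLMin ((h ∷ t) ∷ Bs) (h<rest , hBs) (s ∷ ss) =
  AscentOrRLMin-++ h t (concat Bs) s (proj₁ rest) (proj₂ rest) , h<rest
  where
  rest : AscentOrRLMin (concat Bs) × FirstRLMin (concat Bs)
  rest = concat-AscentOrRLMin Bs hBs ss

∷-Linked< : ∀ {x p} → All (x <_) p → Linked _<_ p → Linked _<_ (x ∷ p)
∷-Linked< {p = []}    _           _ = [-]
∷-Linked< {p = _ ∷ _} (x<y ∷ _) l = x<y ∷ l

record PrefixedCut (xs : List ℕ) : Set where
  field
    prefix         : List ℕ
    blocks         : List (List ℕ)
    xs≡            : xs ≡ prefix ++ concat blocks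
    prefix-sorted  : Linked _<_ prefix
    prefix-exceeds : ExceedsSomeOf prefix (concat blocks)
    heads          : HeadsRLMin blocks
    tails          : TailsNotRLMin blocks
    blocks-sorted  : All (Linked _<_) blocks

∷-prefix-sorted : ∀ {x} p {w} → AscentOrRLMin (x ∷ p ++ w) → ExceedsSomeOf p w →
  Linked _<_ p → Linked _<_ (x ∷ p)
∷-prefix-sorted []      _                _   _ = [-]
∷-prefix-sorted (y ∷ p) (inj₁ x<y , _)   _   l = x<y ∷ l
∷-prefix-sorted (y ∷ p) (inj₂ y<rest , _) p> _ = ⊥-elim (exceeds⇒¬below p p> y<rest)

notRLMin-exceeds : ∀ {x xs} p {w} → xs ≡ p ++ w → All (x ≢_) xs → ¬ All (x <_) xs →
  ExceedsSomeOf p w → ∃[ z ] (z ∈ w × z < x)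
notRLMin-exceeds {x} {xs} p eq x≢xs ¬x<xs p> with find (Allₚ.¬All⇒Any¬ (x <?_) xs ¬x<xs)
... | v , v∈xs , ¬x<v with ∈-++⁻ p (subst (v ∈_) eq v∈xs)
... | inj₁ v∈p = let z , z∈w , z<v = p> v∈p in z , z∈w , <-≤-trans z<v (≮⇒≥ ¬x<v)
... | inj₂ v∈w = v , v∈w , ≤∧≢⇒< (≮⇒≥ ¬x<v) (λ v≡x → All.lookup x≢xs v∈xs (sym v≡x))

prefixedCut : ∀ xs → AscentOrRLMin xs → Unique xs → PrefixedCut xs
prefixedCut [] _ _ = record
  { prefix = [] ; blocks = [] ; xs≡ = refl ; prefix-sorted = [] ; prefix-exceeds = λ ()
  ; heads = tt ; tails = tt ; blocks-sorted = [] }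
prefixedCut (x ∷ xs) w (x≢xs ∷ u) with prefixedCut xs (AscentOrRLMin-tail w) u | All.all? (x <?_) xs
... | c | yes x<xs = record
  { prefix = [] ; blocks = (x ∷ prefix) ∷ blocks ; xs≡ = cong (x ∷_) xs≡ ; prefix-sorted = []
  ; prefix-exceeds = λ ()
  ; heads = subst (All (x <_)) xs≡ x<xs , heads
  ; tails = tail-exceeds′ , tails
  ; blocks-sorted = ∷-Linked< (Allₚ.++⁻ˡ prefix (subst (All (x <_)) xs≡ x<xs)) prefix-sorted
                    ∷ blocks-sorted }
  where
  open PrefixedCut c
  tail-exceeds′ : ∀ {y} → y ∈ x ∷ prefix → y ≢ x → ∃[ z ] (z ∈ concat blocks × z < y)
  tail-exceeds′ (here refl) y≢x = ⊥-elim (y≢x refl)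
  tail-exceeds′ (there y∈p) _   = prefix-exceeds y∈p
... | c | no ¬x<xs = record
  { prefix = x ∷ prefix ; blocks = blocks ; xs≡ = cong (x ∷_) xs≡
  ; prefix-sorted = ∷-prefix-sorted prefix (subst (λ l → AscentOrRLMin (x ∷ l)) xs≡ w)
                      prefix-exceeds prefix-sorted
  ; prefix-exceeds = λ { (here refl) → notRLMin-exceeds prefix xs≡ x≢xs ¬x<xs prefix-exceeds
                       ; (there y∈p) → prefix-exceeds y∈p }
  ; heads = heads ; tails = tails ; blocks-sorted = blocks-sorted }
  where open PrefixedCut c

record RLMinCut (n : ℕ) (Cs : List (List ℕ)) : Set where
  field
    heads        : HeadsRLMin Cs
    tails        : TailsNotRLMin Cs
    sorted       : All (Linked _<_) Cs
    concat↭range : concat Cs ↭ range n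

RLMinCut-unique : ∀ {n Cs Ds} → RLMinCut n Cs → RLMinCut n Ds → concat Cs ≡ concat Ds → Cs ≡ Ds
RLMinCut-unique {Cs = Cs} {Ds} cutC cutD =
  rlMinBlocks-unique Cs Ds (RLMinCut.heads cutC) (RLMinCut.tails cutC)
                           (RLMinCut.heads cutD) (RLMinCut.tails cutD)

FirstRLMin-prefix : ∀ p {w} → FirstRLMin (p ++ w) → ExceedsSomeOf p w → p ≡ []
FirstRLMin-prefix []      _      _  = refl
FirstRLMin-prefix (y ∷ p) y<rest p> = ⊥-elim (exceeds⇒¬below p p> y<rest)

runSorted⇒RLMinCut : ∀ {n σ} → IsRunSorted n σ → ∃[ Cs ] (RLMinCut n Cs × concat Cs ≡ σ)
runSorted⇒RLMinCut {n} (Bs , sp , refl) =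
  blocks , record { heads = heads ; tails = tails ; sorted = blocks-sorted
                  ; concat↭range = subst (_↭ range n) concat≡ concat↭range } , sym concat≡
  where
  open SetPartition sp using (sorted; unique; concat↭range)
  ascent,first : AscentOrRLMin (concat Bs) × FirstRLMin (concat Bs)
  ascent,first = concat-AscentOrRLMin Bs (setPartition⇒HeadsRLMin sp) sorted
  open PrefixedCut (prefixedCut (concat Bs) (proj₁ ascent,first) unique)

  concat≡ : concat Bs ≡ concat blocks
  concat≡ = trans xs≡ (cong (_++ concat blocks)
    (FirstRLMin-prefix prefix (subst FirstRLMin xs≡ (proj₂ ascent,first)) prefix-exceeds))

module Separated {n : ℕ} {P : List (List ℕ)} (sp : IsSetPartition n P) (sep : IsSeparated P) where
  open ThetaBlocks sp public

  separated : ∀ {b i} → b ∈ block P i → suc b ∈ block P i → ⊥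
  separated {i = i} b∈ b+1∈ = sep (block P i) _ (block-∈ P (<length b∈)) b∈ b+1∈

  stayed-exceeds : ∀ {i y} → y ∈ block P i → ¬ Movable P i y → y ≢ hd (block P i) →
    ∃[ z ] ∃[ j ] (i < j × z ∈ block C j × z < y)
  stayed-exceeds {y = zero}  y∈ _ _ = ⊥-elim (<-irrefl refl (proj₁ (bounds y∈)))
  stayed-exceeds {i} {suc b} y∈ ¬mv y≢hd with pred-index y∈ y≢hd
  ... | j , b∈Bⱼ with <-cmp j i
  ... | tri< j<i _ _  = ⊥-elim (¬mv (Movable⁺ P i y≢hd j<i b∈Bⱼ))
  ... | tri≈ _ refl _ = ⊥-elim (separated b∈Bⱼ y∈)
  ... | tri> _ _ i<j with placement b∈Bⱼ
  ... | inj₁ b∈Cⱼ                = b , j , i<j , b∈Cⱼ , ≤-refl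
  ... | inj₂ (_ , refl , mv , _) =
    hd (block P j) , j , i<j , hdP∈C (<length b∈Bⱼ) ,
    <-trans (hd<nonHd b∈Bⱼ (proj₁ (Movable⁻ P j b mv))) ≤-refl

  tailsExceedLater : TailsExceedLater C
  tailsExceedLater i {y} y∈ y≢hd with ∈-θBlocks⁻ P i y∈
  ... | inj₁ (y∈Bᵢ , ¬mv) =
    stayed-exceeds y∈Bᵢ ¬mv (λ y≡ → y≢hd (trans y≡ (sym (hd-C (<length y∈Bᵢ)))))
  ... | inj₂ (y∈Bᵢ₊₁ , mv) =
    hd (block P (suc i)) , suc i , ≤-refl , hdP∈C (<length y∈Bᵢ₊₁) ,
    hd<nonHd y∈Bᵢ₊₁ (proj₁ (Movable⁻ P (suc i) y mv))

  C-rlMinCut : RLMinCut n C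
  C-rlMinCut = record
    { heads        = setPartition⇒HeadsRLMin C-isSetPartition
    ; tails        = TailsExceedLater⇒TailsNotRLMin C tailsExceedLater
    ; sorted       = proj₁ (proj₂ C-isSetPartition)
    ; concat↭range = concatC↭range }

  index-hd : ∀ {x c i} → x ∈ block C c → x ≡ hd (block C c) → x ∈ block P i → i ≡ c
  index-hd {c = c} x∈C x≡hd x∈Bᵢ with ∈-θBlocks⁻ P c x∈C
  ... | inj₁ (x∈B , _)  = index-unique x∈Bᵢ x∈B
  ... | inj₂ (x∈B′ , _) = ⊥-elim (<⇒≱ (hd< ≤-refl (<length x∈B′))
    (subst (hd (block P (suc c)) ≤_) (trans x≡hd (hd-C (<length-C x∈C))) (hd≤ x∈B′)))

  index-moved : ∀ {b c i j} → suc b ∈ block C c → suc b ≢ hd (block C c) → b ∈ block P j → j ≤ c →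
    suc b ∈ block P i → i ≡ suc c
  index-moved {c = c} x∈C x≢hd b∈Bⱼ j≤c x∈Bᵢ with ∈-θBlocks⁻ P c x∈C
  ... | inj₂ (x∈B′ , _)  = index-unique x∈Bᵢ x∈B′
  ... | inj₁ (x∈B , ¬mv) with m≤n⇒m<n∨m≡n j≤c
  ... | inj₁ j<c  =
    ⊥-elim (¬mv (Movable⁺ P c (λ x≡ → x≢hd (trans x≡ (sym (hd-C (<length-C x∈C))))) j<c b∈Bⱼ))
  ... | inj₂ refl = ⊥-elim (separated b∈Bⱼ x∈B)

  index-stayed : ∀ {b c i j} → suc b ∈ block C c → b ∈ block P j → c < j →
    suc b ∈ block P i → i ≡ c
  index-stayed {b} {c} x∈C b∈Bⱼ c<j x∈Bᵢ with ∈-θBlocks⁻ P c x∈C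
  ... | inj₁ (x∈B , _) = index-unique x∈Bᵢ x∈B
  ... | inj₂ (_ , mv) with Movable⁻ P (suc c) (suc b) mv
  ... | _ , j′ , j′≤c , b∈Bⱼ′ with index-unique b∈Bⱼ b∈Bⱼ′
  ... | refl = ⊥-elim (<⇒≱ c<j (≤-pred j′≤c))

blockIndex : List (List ℕ) → ℕ → ℕ
blockIndex []       x = 0
blockIndex (B ∷ Cs) x = if any (_≡ᵇ x) B then 0 else suc (blockIndex Cs x)

blockIndex-∈ : ∀ Cs {x i} → Unique (concat Cs) → x ∈ block Cs i → blockIndex Cs x ≡ i
blockIndex-∈ (B ∷ Cs) {x} {zero} u x∈ with any (_≡ᵇ x) B in eq
... | true  = refl
... | false = ⊥-elim (subst T eq (∈⇒T-any x∈))
blockIndex-∈ (B ∷ Cs) {x} {suc i} u x∈ with any (_≡ᵇ x) B in eq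
... | true  = ⊥-elim (Unique-++-disjoint B u (T-any⇒∈ B (subst T (sym eq) tt)) (block⊆concat Cs i x∈))
... | false = cong suc (blockIndex-∈ Cs (Unique-++⁻ʳ B u) x∈)

labelStep : List (List ℕ) → ℕ → ℕ → ℕ → ℕ
labelStep Cs x c l = if x ≡ᵇ hd (block Cs c) then c else (if l ≤ᵇ c then suc c else c)

-- Read on the blocks Cs = θBlocks P, `label Cs x` is the index of the block of P
-- containing x: x was moved from block c + 1 to block c of Cs exactly when it is
-- not the minimum there and x - 1 lies in a block of P of index at most c.
label : List (List ℕ) → ℕ → ℕ
label Cs zero    = 0
label Cs (suc b) = labelStep Cs (suc b) (blockIndex Cs (suc b)) (label Cs b)

labelStep-hd : ∀ Cs {x c l} → x ≡ hd (block Cs c) → labelStep Cs x c l ≡ c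
labelStep-hd Cs {x} {c} x≡hd with x ≡ᵇ hd (block Cs c) in eq
... | true  = refl
... | false = ⊥-elim (subst T eq (≡⇒≡ᵇ x _ x≡hd))

labelStep-moved : ∀ Cs {x c l} → x ≢ hd (block Cs c) → l ≤ c → labelStep Cs x c l ≡ suc c
labelStep-moved Cs {x} {c} {l} x≢hd l≤c with x ≡ᵇ hd (block Cs c) in eq | l ≤ᵇ c in eq′
... | true  | _     = ⊥-elim (x≢hd (≡ᵇ⇒≡ x _ (subst T (sym eq) tt)))
... | false | true  = refl
... | false | false = ⊥-elim (subst T eq′ (≤⇒≤ᵇ l≤c))

labelStep-stayed : ∀ Cs {x c l} → x ≢ hd (block Cs c) → c < l → labelStep Cs x c l ≡ c
labelStep-stayed Cs {x} {c} {l} x≢hd c<l with x ≡ᵇ hd (block Cs c) | l ≤ᵇ c in eq′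
... | true  | _     = refl
... | false | true  = ⊥-elim (<⇒≱ c<l (≤ᵇ⇒≤ l c (subst T (sym eq′) tt)))
... | false | false = refl

labelClass : ℕ → List (List ℕ) → ℕ → List ℕ
labelClass n Cs i = filterᵇ (λ x → label Cs x ≡ᵇ i) (range n)

∈-labelClass⁻ : ∀ {n Cs i x} → x ∈ labelClass n Cs i → x ∈ range n × label Cs x ≡ i
∈-labelClass⁻ {Cs = Cs} {i} {x} x∈ with ∈-filterᵇ⁻ _ x∈
... | x∈range , l≡ᵇi = x∈range , ≡ᵇ⇒≡ (label Cs x) i l≡ᵇi

rebuild : ℕ → List (List ℕ) → List (List ℕ)
rebuild n Cs = applyUpTo (labelClass n Cs) (length Cs)

block-applyUpTo : ∀ (f : ℕ → List ℕ) k {i} → i < k → block (applyUpTo f k) i ≡ f i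
block-applyUpTo f (suc k) {zero}  _        = refl
block-applyUpTo f (suc k) {suc i} (s≤s i<k) = block-applyUpTo (f ∘ suc) k i<k

module Rebuild {n : ℕ} {Cs : List (List ℕ)} (cut : RLMinCut n Cs) where
  open RLMinCut cut using (heads; tails)

  Cs-isSetPartition : IsSetPartition n Cs
  Cs-isSetPartition =
    nonempty , RLMinCut.sorted cut ,
    block-Linked Cs (λ i i+1< → HeadsRLMin⇒hd< Cs heads ≤-refl
                                   (hd-∈ (All.lookup nonempty (block-∈ Cs i+1<)))) ,
    RLMinCut.concat↭range cut
    where
    nonempty : All (λ B → B ≢ []) Cs
    nonempty = HeadsRLMin⇒nonempty Cs heads

  open SetPartition Cs-isSetPartition

  exceeds : TailsExceedLater Cs
  exceeds = TailsNotRLMin⇒TailsExceedLater Cs tails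

  hd≤later : ∀ {i j z} → i ≤ j → z ∈ block Cs j → hd (block Cs i) ≤ z
  hd≤later i≤j z∈ with m≤n⇒m<n∨m≡n i≤j
  ... | inj₁ i<j  = <⇒≤ (HeadsRLMin⇒hd< Cs heads i<j z∈)
  ... | inj₂ refl = hd≤ z∈

  label-step : ∀ {x c} → x ∈ block Cs c → label Cs x ≡ labelStep Cs x c (label Cs (x ∸ 1))
  label-step {zero}  x∈ = ⊥-elim (<-irrefl refl (proj₁ (bounds x∈)))
  label-step {suc b} x∈ = cong (λ c → labelStep Cs (suc b) c (label Cs b)) (blockIndex-∈ Cs unique x∈)

  label-hd : ∀ {x c} → x ∈ block Cs c → x ≡ hd (block Cs c) → label Cs x ≡ c
  label-hd {x} x∈ x≡hd = trans (label-step x∈) (labelStep-hd Cs {l = label Cs (x ∸ 1)} x≡hd)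

  label-moved : ∀ {x c} → x ∈ block Cs c → x ≢ hd (block Cs c) → label Cs (x ∸ 1) ≤ c →
    label Cs x ≡ suc c
  label-moved x∈ x≢hd l≤c = trans (label-step x∈) (labelStep-moved Cs x≢hd l≤c)

  label-stayed : ∀ {x c} → x ∈ block Cs c → x ≢ hd (block Cs c) → c < label Cs (x ∸ 1) →
    label Cs x ≡ c
  label-stayed x∈ x≢hd c<l = trans (label-step x∈) (labelStep-stayed Cs x≢hd c<l)

  label<length : ∀ {x c} → x ∈ block Cs c → label Cs x < length Cs
  label<length {x} {c} x∈ with x ≟ hd (block Cs c)
  ... | yes x≡hd = subst (_< length Cs) (sym (label-hd x∈ x≡hd)) (<length x∈)
  ... | no x≢hd with exceeds c x∈ x≢hd | label Cs (x ∸ 1) ≤? c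
  ... | _ , j , c<j , z∈ , _ | yes l≤c =
    subst (_< length Cs) (sym (label-moved x∈ x≢hd l≤c)) (<-≤-trans (s≤s c<j) (<length z∈))
  ... | _ , j , c<j , z∈ , _ | no l≰c =
    subst (_< length Cs) (sym (label-stayed x∈ x≢hd (≰⇒> l≰c))) (<-trans c<j (<length z∈))

  hd-labelBlock≤ : ∀ {y c} → y ∈ block Cs c → hd (block Cs (label Cs y)) ≤ y
  hd-labelBlock≤ {y} {c} y∈ with y ≟ hd (block Cs c)
  ... | yes y≡hd = subst (λ k → hd (block Cs k) ≤ y) (sym (label-hd y∈ y≡hd)) (hd≤ y∈)
  ... | no y≢hd with label Cs (y ∸ 1) ≤? c
  ... | no l≰c = subst (λ k → hd (block Cs k) ≤ y) (sym (label-stayed y∈ y≢hd (≰⇒> l≰c))) (hd≤ y∈)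
  ... | yes l≤c with exceeds c y∈ y≢hd
  ... | z , j , c<j , z∈ , z<y = subst (λ k → hd (block Cs k) ≤ y) (sym (label-moved y∈ y≢hd l≤c))
                                   (≤-trans (hd≤later c<j z∈) (<⇒≤ z<y))

  label≡c⊎suc : ∀ {x c} → x ∈ block Cs c → label Cs x ≡ c ⊎ label Cs x ≡ suc c
  label≡c⊎suc {x} {c} x∈ with x ≟ hd (block Cs c)
  ... | yes x≡hd = inj₁ (label-hd x∈ x≡hd)
  ... | no x≢hd with label Cs (x ∸ 1) ≤? c
  ... | yes l≤c = inj₂ (label-moved x∈ x≢hd l≤c)
  ... | no l≰c  = inj₁ (label-stayed x∈ x≢hd (≰⇒> l≰c))

  label≡suc⁻ : ∀ {x c} → x ∈ block Cs c → label Cs x ≡ suc c →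
    x ≢ hd (block Cs c) × label Cs (x ∸ 1) ≤ c
  label≡suc⁻ {x} {c} x∈ l≡ with x ≟ hd (block Cs c)
  ... | yes x≡hd = ⊥-elim (1+n≢n (sym (trans (sym (label-hd x∈ x≡hd)) l≡)))
  ... | no x≢hd with label Cs (x ∸ 1) ≤? c
  ... | yes l≤c = x≢hd , l≤c
  ... | no l≰c  = ⊥-elim (1+n≢n (sym (trans (sym (label-stayed x∈ x≢hd (≰⇒> l≰c))) l≡)))

  P′ : List (List ℕ)
  P′ = rebuild n Cs

  length-P′ : length P′ ≡ length Cs
  length-P′ = length-applyUpTo (labelClass n Cs) (length Cs)

  block-P′ : ∀ {i} → i < length Cs → block P′ i ≡ labelClass n Cs i
  block-P′ = block-applyUpTo (labelClass n Cs) (length Cs)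

  ∈-P′⁻ : ∀ {x i} → x ∈ block P′ i → (0 < x × x ≤ n) × label Cs x ≡ i
  ∈-P′⁻ {x} {i} x∈ = map₁ ∈-range⁻ (∈-labelClass⁻ (subst (x ∈_) (block-P′ i<) x∈))
    where
    i< : i < length Cs
    i< = subst (i <_) length-P′ (∈-block⇒<length P′ i x∈)

  ∈-P′⁺ : ∀ {x i} → 0 < x → x ≤ n → label Cs x ≡ i → x ∈ block P′ i
  ∈-P′⁺ {x} 0<x x≤n refl = subst (x ∈_) (sym (block-P′ (label<length (proj₂ (index 0<x x≤n)))))
    (∈-filterᵇ⁺ _ (∈-range⁺ 0<x x≤n) (≡⇒≡ᵇ (label Cs x) _ refl))

  sorted-P′ : ∀ i → Linked _<_ (block P′ i)
  sorted-P′ i with i <? length Cs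
  ... | yes i< = subst (Linked _<_) (sym (block-P′ i<))
                   (Linkedₚ.filter⁺ (T? ∘ λ x → label Cs x ≡ᵇ i) <-trans (range-sorted n))
  ... | no i≮  =
    subst (Linked _<_) (sym (block-≥length P′ (subst (_≤ i) (sym length-P′) (≮⇒≥ i≮)))) []

  hdCs∈P′ : ∀ {i} → i < length Cs → hd (block Cs i) ∈ block P′ i
  hdCs∈P′ i< = let h∈ = hd∈ i< in uncurry ∈-P′⁺ (bounds h∈) (label-hd h∈ refl)

  hd-P′ : ∀ {i} → i < length Cs → hd (block P′ i) ≡ hd (block Cs i)
  hd-P′ {i} i< = hd-≡ (sorted-P′ i) (hdCs∈P′ i<) hd≤y
    where
    hd≤y : ∀ {y} → y ∈ block P′ i → hd (block Cs i) ≤ y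
    hd≤y y∈ with ∈-P′⁻ y∈
    ... | (0<y , y≤n) , refl = hd-labelBlock≤ (proj₂ (index 0<y y≤n))

  unique-P′ : Unique (concat P′)
  unique-P′ = UniqueSₚ.concat⁺ (setoid ℕ)
    (Allₚ.applyUpTo⁺₁ _ (length Cs) (λ _ → Uniqueₚ.filter⁺ (T? ∘ _) (range-unique n)))
    (AllPairsₚ.applyUpTo⁺₁ _ (length Cs) (λ i<j _ (x∈i , x∈j) →
      <-irrefl (trans (sym (proj₂ (∈-labelClass⁻ {n} {Cs} x∈i))) (proj₂ (∈-labelClass⁻ {n} {Cs} x∈j)))
               i<j))

  concatP′↭range : concat P′ ↭ range n
  concatP′↭range = Unique∧sameMembers⇒↭ unique-P′ (range-unique n) (mk⇔ to from)
    where
    to : ∀ {x} → x ∈ concat P′ → x ∈ range n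
    to x∈ = let _ , x∈P′ᵢ = concat⇒block P′ x∈ in uncurry ∈-range⁺ (proj₁ (∈-P′⁻ x∈P′ᵢ))
    from : ∀ {x} → x ∈ range n → x ∈ concat P′
    from x∈ = let 0<x , x≤n = ∈-range⁻ x∈ in block⊆concat P′ _ (∈-P′⁺ 0<x x≤n refl)

  P′-isSetPartition : IsSetPartition n P′
  P′-isSetPartition =
      block-All P′ (λ i i< → ∈⇒≢[] (hdCs∈P′ (subst (i <_) length-P′ i<)))
    , block-All P′ (λ i _ → sorted-P′ i)
    , block-Linked P′ (λ i i< → let i+1< = subst (suc i <_) length-P′ i< in
        subst₂ _<_ (sym (hd-P′ (<-trans ≤-refl i+1<))) (sym (hd-P′ i+1<)) (hd< ≤-refl i+1<))
    , concatP′↭range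

  label-separated : ∀ {b} → 0 < b → suc b ≤ n → label Cs (suc b) ≢ label Cs b
  label-separated {b} 0<b b<n l≡ with index (s≤s z≤n) b<n | index 0<b (<⇒≤ b<n)
  ... | c , x∈ | _ , b∈ with suc b ≟ hd (block Cs c)
  ... | yes x≡hd = <-irrefl refl (subst (_≤ b) (sym x≡hd)
    (subst (λ k → hd (block Cs k) ≤ b) (trans (sym l≡) (label-hd x∈ x≡hd)) (hd-labelBlock≤ b∈)))
  ... | no x≢hd with label Cs b ≤? c
  ... | yes l≤c = <-irrefl refl (subst (_≤ c) (trans (sym l≡) (label-moved x∈ x≢hd l≤c)) l≤c)
  ... | no l≰c  = l≰c (≤-reflexive (trans (sym l≡) (label-stayed x∈ x≢hd (≰⇒> l≰c))))

  P′-separated : IsSeparated P′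
  P′-separated B b B∈ b∈ b+1∈ with ∈⇒block P′ B∈
  ... | i , refl with ∈-P′⁻ b∈ | ∈-P′⁻ b+1∈
  ... | (0<b , _) , lb≡i | (_ , b<n) , lb+1≡i = label-separated 0<b b<n (trans lb+1≡i (sym lb≡i))

  Movable-P′⁺ : ∀ {x c} → x ∈ block Cs c → label Cs x ≡ suc c → Movable P′ (suc c) x
  Movable-P′⁺ {x} {c} x∈ l≡suc with label≡suc⁻ x∈ l≡suc
  ... | x≢hd , l-1≤c =
    Movable⁺ P′ (suc c) x≢hdP′ (s≤s l-1≤c) (uncurry ∈-P′⁺ (pred-bounds x∈ x≢hd) refl)
    where
    c+1< : suc c < length Cs
    c+1< = subst (_< length Cs) l≡suc (label<length x∈)
    x≢hdP′ : x ≢ hd (block P′ (suc c))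
    x≢hdP′ x≡ = 1+n≢n (sym (index-unique x∈
      (subst (_∈ block Cs (suc c)) (sym (trans x≡ (hd-P′ c+1<))) (hd∈ c+1<))))

  Movable-P′⇒ : ∀ {x c i} → x ∈ block Cs c → x ∈ block P′ i → Movable P′ i x → i ≡ suc c
  Movable-P′⇒ {x} {c} x∈ x∈P′ mv with ∈-P′⁻ x∈P′
  ... | _ , refl with label≡c⊎suc x∈ | Movable⁻ P′ (label Cs x) x mv
  ... | inj₂ l≡suc | _ = l≡suc
  ... | inj₁ l≡c   | x≢hd , j , j<l , x-1∈ =
    ⊥-elim (1+n≢n (trans (sym (label-moved x∈ x≢hdC l-1≤c)) l≡c))
    where
    x≢hdC : x ≢ hd (block Cs c)
    x≢hdC x≡ = x≢hd (trans x≡ (trans (cong (hd ∘ block Cs) (sym l≡c)) (sym (hd-P′ (label<length x∈)))))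
    l-1≤c : label Cs (x ∸ 1) ≤ c
    l-1≤c = <⇒≤ (subst₂ _<_ (sym (proj₂ (∈-P′⁻ x-1∈))) l≡c j<l)

  ¬Movable-P′⇒ : ∀ {x c i} → x ∈ block Cs c → x ∈ block P′ i → ¬ Movable P′ i x → i ≡ c
  ¬Movable-P′⇒ {x} x∈ x∈P′ ¬mv with ∈-P′⁻ x∈P′ | label≡c⊎suc x∈
  ... | _ , refl | inj₁ l≡c   = l≡c
  ... | _ , refl | inj₂ l≡suc =
    ⊥-elim (¬mv (subst (λ k → Movable P′ k x) (sym l≡suc) (Movable-P′⁺ x∈ l≡suc)))

  ∈-P′⇒∈Cs : ∀ {x i} → x ∈ block P′ i → ∃[ c ] (x ∈ block Cs c)
  ∈-P′⇒∈Cs x∈ = uncurry index (proj₁ (∈-P′⁻ x∈))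

  ∈-θBlocks-P′⁻ : ∀ {x i} → x ∈ block (θBlocks P′) i → x ∈ block Cs i
  ∈-θBlocks-P′⁻ {x} {i} x∈ with ∈-θBlocks⁻ P′ i x∈
  ... | inj₁ (x∈P′ᵢ , ¬mv) = let c , x∈Cs = ∈-P′⇒∈Cs x∈P′ᵢ in
    subst (λ k → x ∈ block Cs k) (sym (¬Movable-P′⇒ x∈Cs x∈P′ᵢ ¬mv)) x∈Cs
  ... | inj₂ (x∈P′ᵢ₊₁ , mv) = let c , x∈Cs = ∈-P′⇒∈Cs x∈P′ᵢ₊₁ in
    subst (λ k → x ∈ block Cs k) (sym (suc-injective (Movable-P′⇒ x∈Cs x∈P′ᵢ₊₁ mv))) x∈Cs

  ∈-θBlocks-P′⁺ : ∀ {x i} → x ∈ block Cs i → x ∈ block (θBlocks P′) i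
  ∈-θBlocks-P′⁺ {x} {i} x∈ with bounds x∈ | label≡c⊎suc x∈
  ... | 0<x , x≤n | inj₁ l≡i =
    let x∈P′ᵢ = ∈-P′⁺ 0<x x≤n l≡i in
    ∈-θBlocks⁺ˢ P′ i x∈P′ᵢ (λ mv → 1+n≢n (sym (Movable-P′⇒ x∈ x∈P′ᵢ mv)))
  ... | 0<x , x≤n | inj₂ l≡suc = ∈-θBlocks⁺ᵐ P′ i (∈-P′⁺ 0<x x≤n l≡suc) (Movable-P′⁺ x∈ l≡suc)

  θBlocks-P′ : θBlocks P′ ≡ Cs
  θBlocks-P′ = block-ext (θBlocks P′) Cs (trans (length-newBlocks [] P′) length-P′)
    (λ i → strictlySorted-ext (ThetaBlocks.sorted-C P′-isSetPartition i) (blockSorted i)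
             ∈-θBlocks-P′⁻ ∈-θBlocks-P′⁺)

module _ {n : ℕ} {P : List (List ℕ)} (sp : IsSetPartition n P) (sep : IsSeparated P) where
  private
    open Separated sp sep
    module CP = SetPartition C-isSetPartition
    module R = Rebuild C-rlMinCut

  label-θBlocks : ∀ x {i} → x ∈ block P i → label C x ≡ i
  label-θBlocks zero    x∈ = ⊥-elim (<-irrefl refl (proj₁ (bounds x∈)))
  label-θBlocks (suc b) x∈ with uncurry CP.index (bounds x∈)
  ... | c , x∈C with suc b ≟ hd (block C c)
  ... | yes x≡hd = trans (R.label-hd x∈C x≡hd) (sym (index-hd x∈C x≡hd x∈))
  ... | no x≢hd with uncurry index (CP.pred-bounds x∈C x≢hd)
  ... | j , b∈Bⱼ with j ≤? c
  ... | yes j≤c = trans (R.label-moved x∈C x≢hd (subst (_≤ c) (sym (label-θBlocks b b∈Bⱼ)) j≤c))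
                        (sym (index-moved x∈C x≢hd b∈Bⱼ j≤c x∈))
  ... | no j≰c  = trans (R.label-stayed x∈C x≢hd (subst (c <_) (sym (label-θBlocks b b∈Bⱼ)) (≰⇒> j≰c)))
                        (sym (index-stayed x∈C b∈Bⱼ (≰⇒> j≰c) x∈))

  rebuild-θBlocks : rebuild n (θBlocks P) ≡ P
  rebuild-θBlocks = block-ext R.P′ P (trans R.length-P′ length-C)
    (λ i → strictlySorted-ext (R.sorted-P′ i) (blockSorted i) to from)
    where
    to : ∀ {x i} → x ∈ block R.P′ i → x ∈ block P i
    to x∈ with R.∈-P′⁻ x∈
    ... | (0<x , x≤n) , refl with index 0<x x≤n
    ... | j , x∈Bⱼ = subst (λ k → _ ∈ block P k) (sym (label-θBlocks _ x∈Bⱼ)) x∈Bⱼ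
    from : ∀ {x i} → x ∈ block P i → x ∈ block R.P′ i
    from x∈ = uncurry R.∈-P′⁺ (bounds x∈) (label-θBlocks _ x∈)

θ-injective : ∀ {n P Q} → IsSepPartition n P → IsSepPartition n Q → θ P ≡ θ Q → P ≡ Q
θ-injective {n} {P} {Q} (spP , sepP) (spQ , sepQ) θP≡θQ = begin
  P                     ≡⟨ rebuild-θBlocks spP sepP ⟨
  rebuild n (θBlocks P) ≡⟨ cong (rebuild n) θBlocks≡ ⟩
  rebuild n (θBlocks Q) ≡⟨ rebuild-θBlocks spQ sepQ ⟩
  Q                     ∎
  where
  open ≡-Reasoning
  θBlocks≡ : θBlocks P ≡ θBlocks Q
  θBlocks≡ = RLMinCut-unique (Separated.C-rlMinCut spP sepP) (Separated.C-rlMinCut spQ sepQ) θP≡θQ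

θ-surjective : ∀ {n σ} → IsRunSorted n σ → ∃[ P ] (IsSepPartition n P × θ P ≡ σ)
θ-surjective rs with runSorted⇒RLMinCut rs
... | Cs , cut , concat≡σ =
  P′ , (P′-isSetPartition , P′-separated) , trans (cong concat θBlocks-P′) concat≡σ
  where open Rebuild cut

theorem35 : (n : ℕ) →
    ((P : List (List ℕ)) → IsSepPartition n P → IsRunSorted n (θ P)) ×
    ((P Q : List (List ℕ)) → IsSepPartition n P → IsSepPartition n Q → θ P ≡ θ Q → P ≡ Q) ×
    ((σ : List ℕ) → IsRunSorted n σ → ∃[ P ] (IsSepPartition n P × θ P ≡ σ))
theorem35 n = (λ _ → θ-runSorted ∘ proj₁) , (λ _ _ → θ-injective) , (λ _ → θ-surjective)
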